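{- For each positive integer $m$, $d^*_{m+1}(2m)=D_{m-1}$ and $d_m(2m-1)=d^*_m(2m-1)=D_{m-1}$.
   Context: For a positive integer $n$, $S_n$ is the set of permutations of $\{1,\dots,n\}$, written in one-line notation $a_1a_2\cdots a_n$ with $a_i=w(i)$. A permutation is alternating if $a_1>a_2<a_3>a_4<\cdots$, and reverse alternating if $a_1<a_2>a_3<a_4>\cdots$. A fixed point of $w$ is an $i$ with $w(i)=i$. $d_k(n)$ (resp. $d^*_k(n)$) denotes the number of alternating (resp. reverse alternating) permutations in $S_n$ with exactly $k$ fixed points. $D_n$ denotes the number of derangements (permutations without fixed points) in $S_n$, with $D_0=1$. -}

module Defs where

open import Data.Nat using (ℕ; zero; suc; _<ᵇ_; _+_)
open import Data.Bool using (Bool; true; false; _∧_; not; if_then_else_)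
open import Data.Fin using (Fin; toℕ; _≟_)
open import Data.List using (List; []; _∷_; length; filter; map; concatMap; allFin)
open import Data.List.Relation.Unary.Unique.DecPropositional using (unique?)
open import Relation.Nullary.Decidable using (does)

words : (n k : ℕ) → List (List (Fin n))
words n zero    = [] ∷ []
words n (suc k) = concatMap (λ w → map (λ a → a ∷ w) (allFin n)) (words n k)

-- S_n: permutations of {1,…,n} in one-line notation a₁a₂⋯aₙ, with the value j
-- encoded as (j-1) : Fin n.  A word of length n over Fin n with pairwise
-- distinct letters is exactly an injective (hence bijective) map Fin n → Fin n.
perms : (n : ℕ) → List (List (Fin n))
perms n = filter (λ w → unique? _≟_ w) (words n n)

zigzag : {n : ℕ} → Bool → List (Fin n) → Bool
zigzag b []           = true
zigzag b (x ∷ [])     = true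
zigzag b (x ∷ y ∷ w)  =
  (if b then toℕ y <ᵇ toℕ x else toℕ x <ᵇ toℕ y) ∧ zigzag (not b) (y ∷ w)

alternating : {n : ℕ} → List (Fin n) → Bool
alternating = zigzag true

revAlternating : {n : ℕ} → List (Fin n) → Bool
revAlternating = zigzag false

-- number of fixed points: positions i (1-based) with aᵢ = i; here position
-- counter i is 0-based, matching the 0-based encoding of the values.
fixFrom : {n : ℕ} → ℕ → List (Fin n) → ℕ
fixFrom i []      = 0
fixFrom i (a ∷ w) = (if does (toℕ a Data.Nat.≟ i) then 1 else 0) + fixFrom (suc i) w

fixedPoints : {n : ℕ} → List (Fin n) → ℕ
fixedPoints = fixFrom 0

hasFix : {n : ℕ} → ℕ → List (Fin n) → Bool
hasFix k w = does (fixedPoints w Data.Nat.≟ k)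

d : ℕ → ℕ → ℕ
d k n = length (filter (λ w → (Data.Bool._≟_ (alternating w ∧ hasFix k w) true)) (perms n))

d* : ℕ → ℕ → ℕ
d* k n = length (filter (λ w → (Data.Bool._≟_ (revAlternating w ∧ hasFix k w) true)) (perms n))

-- D_n: number of derangements in S_n (D_0 = 1, the empty permutation)
D : ℕ → ℕ
D n = length (filter (λ w → fixedPoints w Data.Nat.≟ 0) (perms n))

module Submission where

-- Split the positions 0 … L-1, L = s + 2m + e with s, e ≤ 1, into s leading positions, m consecutive
-- pairs and e trailing ones; with the zigzag direction fixed by s, every pair is a descent and so
-- contains at most one fixed point. Hence s + m + e fixed points force every leading and trailing
-- position to be fixed and exactly one fixed point in each pair. Sending j to the pair that receives
-- the value of the non-fixed entry of pair j gives a derangement σ of {0, …, m-1}, and σ determines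
-- the permutation back: the non-fixed entry of pair j is the first one (carrying the larger value)
-- when j < σ j and the second one otherwise. The three identities are the cases
-- (s, e) = (1, 1), (0, 1) and (1, 0).

open import Defs
open import Data.Bool using (Bool; true; false; T; _∧_; not; if_then_else_)
import Data.Bool as Bool
open import Data.Bool.Properties using (∧-conicalˡ; ∧-conicalʳ)
open import Data.Empty using (⊥-elim)
open import Data.Fin using (Fin; toℕ; fromℕ<)
import Data.Fin as Fin
open import Data.Fin.Properties using (toℕ-injective; toℕ-fromℕ<; toℕ<n)
open import Data.List using (List; []; _∷_; length; filter; map; concatMap; allFin; applyUpTo; cartesianProductWith; _++_)
open import Data.List.Properties using (length-map; map-injective; length-applyUpTo; length-removeAt′)
open import Data.List.Membership.Propositional using (_∈_; _─_)
open import Data.List.Membership.Propositional.Properties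
  using (∈-filter⁺; ∈-filter⁻; ∈-cartesianProductWith⁺; ∈-cartesianProductWith⁻; ∈-allFin)
open import Data.List.Relation.Unary.Any using (here; there; index)
open import Data.List.Relation.Unary.All using (All; []; _∷_)
import Data.List.Relation.Unary.All as All
import Data.List.Relation.Unary.All.Properties as All
open import Data.List.Relation.Unary.AllPairs using ([]; _∷_)
open import Data.List.Relation.Unary.Unique.Propositional using (Unique)
import Data.List.Relation.Unary.Unique.Propositional.Properties as Unique
open import Data.List.Relation.Unary.Unique.DecPropositional using (unique?)
open import Data.Nat using (ℕ; zero; suc; _+_; _*_; _∸_; _≤_; _<_; _≮_; _≟_; _≤?_; _<?_; _<ᵇ_; z≤n; s≤s; z<s; s<s)
open import Data.Nat.Properties
open import Data.Product using (_×_; _,_; proj₁; proj₂)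
open import Data.Sum using (_⊎_; inj₁; inj₂)
open import Data.Unit using (tt)
open import Function using (_∘_)
open import Relation.Nullary using (¬_; Dec; yes; no; does)
open import Relation.Nullary.Decidable using (dec-true; dec-false; _×-dec_)
open import Relation.Binary.PropositionalEquality

∈-─ : {A : Set} {x z : A} {ys : List A} (p : x ∈ ys) → z ∈ ys → z ≢ x → z ∈ ys ─ p
∈-─ (here refl) (here refl) z≢x = ⊥-elim (z≢x refl)
∈-─ (here refl) (there q)   _   = q
∈-─ (there p)   (here refl) _   = here refl
∈-─ (there p)   (there q)   z≢x = there (∈-─ p q z≢x)

InjectiveOn : {A B : Set} → List A → (A → B) → Set
InjectiveOn xs f = ∀ {x y} → x ∈ xs → y ∈ xs → f x ≡ f y → x ≡ y

length-≤-injection : {A B : Set} (f : A → B) (xs : List A) (ys : List B) → Unique xs →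
  (∀ {x} → x ∈ xs → f x ∈ ys) → InjectiveOn xs f → length xs ≤ length ys
length-≤-injection f []       ys _          _    _   = z≤n
length-≤-injection f (x ∷ xs) ys (x∉ ∷ uxs) f∈ys inj =
  subst (suc (length xs) ≤_) (sym (length-removeAt′ ys (index fx∈ys)))
    (s≤s (length-≤-injection f xs (ys ─ fx∈ys) uxs f∈ys─ (λ p q → inj (there p) (there q))))
  where
  fx∈ys = f∈ys (here refl)
  f∈ys─ : ∀ {z} → z ∈ xs → f z ∈ ys ─ fx∈ys
  f∈ys─ z∈xs = ∈-─ fx∈ys (f∈ys (there z∈xs))
    (λ fz≡fx → All.lookup x∉ z∈xs (sym (inj (there z∈xs) (here refl) fz≡fx)))

length-≡-bijection : {A B : Set} (f : A → B) (g : B → A) (xs : List A) (ys : List B) →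
  Unique xs → Unique ys → (∀ {x} → x ∈ xs → f x ∈ ys) → (∀ {y} → y ∈ ys → g y ∈ xs) →
  (∀ {x} → x ∈ xs → g (f x) ≡ x) → (∀ {y} → y ∈ ys → f (g y) ≡ y) → length xs ≡ length ys
length-≡-bijection f g xs ys uxs uys f∈ g∈ gf fg = ≤-antisym
  (length-≤-injection f xs ys uxs f∈ (λ p q e → trans (sym (gf p)) (trans (cong g e) (gf q))))
  (length-≤-injection g ys xs uys g∈ (λ p q e → trans (sym (fg p)) (trans (cong f e) (fg q))))

words-suc : (n k : ℕ) → words n (suc k) ≡ cartesianProductWith (λ w a → a ∷ w) (words n k) (allFin n)
words-suc n k = go (words n k)
  where
  go : (ws : List (List (Fin n))) →
       concatMap (λ w → map (λ a → a ∷ w) (allFin n)) ws ≡ cartesianProductWith (λ w a → a ∷ w) ws (allFin n)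
  go []       = refl
  go (w ∷ ws) = cong (map (λ a → a ∷ w) (allFin n) ++_) (go ws)

Unique-words : (n k : ℕ) → Unique (words n k)
Unique-words n zero    = [] ∷ []
Unique-words n (suc k) = subst Unique (sym (words-suc n k))
  (Unique.cartesianProductWith⁺ (λ w a → a ∷ w) ∷-injective (Unique-words n k) (Unique.allFin⁺ n))
  where
  ∷-injective : ∀ {w v : List (Fin n)} {a b} → a ∷ w ≡ b ∷ v → w ≡ v × a ≡ b
  ∷-injective refl = refl , refl

length-∈-words : (n k : ℕ) {w : List (Fin n)} → w ∈ words n k → length w ≡ k
length-∈-words n zero    (here refl) = refl
length-∈-words n (suc k) {w} w∈
  with _ , _ , v∈ , _ , refl ← ∈-cartesianProductWith⁻ (λ w a → a ∷ w) (words n k) (allFin n)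
                                  (subst (w ∈_) (words-suc n k) w∈)
  = cong suc (length-∈-words n k v∈)

∈-words : (n : ℕ) (w : List (Fin n)) → w ∈ words n (length w)
∈-words n []      = here refl
∈-words n (a ∷ w) = subst ((a ∷ w) ∈_) (sym (words-suc n (length w)))
  (∈-cartesianProductWith⁺ (λ w a → a ∷ w) (∈-words n w) (∈-allFin a))

Unique-perms : (n : ℕ) → Unique (perms n)
Unique-perms n = Unique.filter⁺ (unique? Fin._≟_) (Unique-words n n)

∈-perms⁻ : {n : ℕ} {w : List (Fin n)} → w ∈ perms n → length w ≡ n × Unique w
∈-perms⁻ {n} w∈ with w∈words , uw ← ∈-filter⁻ (unique? Fin._≟_) {xs = words n n} w∈ =
  length-∈-words n n w∈words , uw

∈-perms⁺ : {n : ℕ} {w : List (Fin n)} → length w ≡ n → Unique w → w ∈ perms n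
∈-perms⁺ {n} {w} len≡n uw =
  ∈-filter⁺ (unique? Fin._≟_) (subst (λ k → w ∈ words n k) len≡n (∈-words n w)) uw

nth : List ℕ → ℕ → ℕ
nth []       _       = 0
nth (x ∷ xs) zero    = x
nth (x ∷ xs) (suc k) = nth xs k

applyUpTo-nth : (xs : List ℕ) → applyUpTo (nth xs) (length xs) ≡ xs
applyUpTo-nth []       = refl
applyUpTo-nth (x ∷ xs) = cong (x ∷_) (applyUpTo-nth xs)

nth-applyUpTo : (a : ℕ → ℕ) (n : ℕ) {k : ℕ} → k < n → nth (applyUpTo a n) k ≡ a k
nth-applyUpTo a (suc n) {zero}  _         = refl
nth-applyUpTo a (suc n) {suc k} (s<s k<n) = nth-applyUpTo (a ∘ suc) n k<n

applyUpTo-cong : (n : ℕ) {a b : ℕ → ℕ} → (∀ {k} → k < n → a k ≡ b k) → applyUpTo a n ≡ applyUpTo b n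
applyUpTo-cong zero    a≗b = refl
applyUpTo-cong (suc n) a≗b = cong₂ _∷_ (a≗b z<s) (applyUpTo-cong n (a≗b ∘ s<s))

InjectiveBelow : ℕ → (ℕ → ℕ) → Set
InjectiveBelow n a = ∀ {j k} → j < n → k < n → a j ≡ a k → j ≡ k

Unique-applyUpTo⁻ : (n : ℕ) (a : ℕ → ℕ) → Unique (applyUpTo a n) → InjectiveBelow n a
Unique-applyUpTo⁻ (suc n) a (a0∉ ∷ u) {zero}  {zero}  _         _         _ = refl
Unique-applyUpTo⁻ (suc n) a (a0∉ ∷ u) {zero}  {suc k} _         (s<s k<n) e =
  ⊥-elim (All.applyUpTo⁻ (a ∘ suc) n a0∉ k<n e)
Unique-applyUpTo⁻ (suc n) a (a0∉ ∷ u) {suc j} {zero}  (s<s j<n) _         e =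
  ⊥-elim (All.applyUpTo⁻ (a ∘ suc) n a0∉ j<n (sym e))
Unique-applyUpTo⁻ (suc n) a (a0∉ ∷ u) {suc j} {suc k} (s<s j<n) (s<s k<n) e =
  cong suc (Unique-applyUpTo⁻ n (a ∘ suc) u j<n k<n e)

Unique-applyUpTo⁺ : (n : ℕ) (a : ℕ → ℕ) → InjectiveBelow n a → Unique (applyUpTo a n)
Unique-applyUpTo⁺ n a inj =
  Unique.applyUpTo⁺₁ a n (λ i<j j<n e → <⇒≢ i<j (inj (<-trans i<j j<n) j<n e))

Step : Bool → ℕ → ℕ → Set
Step true  x y = y < x
Step false x y = x < y

stepᵇ : Bool → ℕ → ℕ → Bool
stepᵇ b x y = if b then y <ᵇ x else x <ᵇ y

stepᵇ-sound : (b : Bool) {x y : ℕ} → stepᵇ b x y ≡ true → Step b x y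
stepᵇ-sound true  {x} {y} e = <ᵇ⇒< y x (subst T (sym e) tt)
stepᵇ-sound false {x} {y} e = <ᵇ⇒< x y (subst T (sym e) tt)

stepᵇ-complete : (b : Bool) {x y : ℕ} → Step b x y → stepᵇ b x y ≡ true
stepᵇ-complete true  {x} {y} y<x with y <ᵇ x | <⇒<ᵇ y<x
... | true | _ = refl
stepᵇ-complete false {x} {y} x<y with x <ᵇ y | <⇒<ᵇ x<y
... | true | _ = refl

Step-down : {b : Bool} {x y : ℕ} → b ≡ true → y < x → Step b x y
Step-down refl y<x = y<x

Step-up : {b : Bool} {x y : ℕ} → b ≡ false → x < y → Step b x y
Step-up refl x<y = x<y

stepAt : Bool → ℕ → Bool
stepAt b zero    = b
stepAt b (suc k) = stepAt (not b) k

zigzagℕ : Bool → List ℕ → Bool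
zigzagℕ b []          = true
zigzagℕ b (x ∷ [])    = true
zigzagℕ b (x ∷ y ∷ w) = stepᵇ b x y ∧ zigzagℕ (not b) (y ∷ w)

zigzag-map-toℕ : {n : ℕ} (b : Bool) (w : List (Fin n)) → zigzag b w ≡ zigzagℕ b (map toℕ w)
zigzag-map-toℕ b []          = refl
zigzag-map-toℕ b (x ∷ [])    = refl
zigzag-map-toℕ b (x ∷ y ∷ w) = cong (stepᵇ b (toℕ x) (toℕ y) ∧_) (zigzag-map-toℕ (not b) (y ∷ w))

Zigzag : Bool → ℕ → (ℕ → ℕ) → Set
Zigzag b n a = ∀ {k} → suc k < n → Step (stepAt b k) (a k) (a (suc k))

zigzagℕ-applyUpTo⁻ : (b : Bool) (n : ℕ) (a : ℕ → ℕ) → zigzagℕ b (applyUpTo a n) ≡ true → Zigzag b n a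
zigzagℕ-applyUpTo⁻ b (suc zero)    a e {zero}  (s<s ())
zigzagℕ-applyUpTo⁻ b (suc (suc n)) a e {zero}  _ = stepᵇ-sound b (∧-conicalˡ _ _ e)
zigzagℕ-applyUpTo⁻ b (suc (suc n)) a e {suc k} (s<s k<n) =
  zigzagℕ-applyUpTo⁻ (not b) (suc n) (a ∘ suc) (∧-conicalʳ (stepᵇ b (a 0) (a 1)) _ e) k<n

zigzagℕ-applyUpTo⁺ : (b : Bool) (n : ℕ) (a : ℕ → ℕ) → Zigzag b n a → zigzagℕ b (applyUpTo a n) ≡ true
zigzagℕ-applyUpTo⁺ b zero          a _  = refl
zigzagℕ-applyUpTo⁺ b (suc zero)    a _  = refl
zigzagℕ-applyUpTo⁺ b (suc (suc n)) a za =
  cong₂ _∧_ (stepᵇ-complete b (za (s<s z<s))) (zigzagℕ-applyUpTo⁺ (not b) (suc n) (a ∘ suc) (za ∘ s<s))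

δ : ℕ → ℕ → ℕ
δ x y = if does (x ≟ y) then 1 else 0

δ-≡ : {x y : ℕ} → x ≡ y → δ x y ≡ 1
δ-≡ {x} {y} x≡y = cong (if_then 1 else 0) (dec-true (x ≟ y) x≡y)

δ-refl : (x : ℕ) → δ x x ≡ 1
δ-refl x = δ-≡ {x} refl

δ-≢ : {x y : ℕ} → x ≢ y → δ x y ≡ 0
δ-≢ {x} {y} x≢y = cong (if_then 1 else 0) (dec-false (x ≟ y) x≢y)

δ≤1 : (x y : ℕ) → δ x y ≤ 1
δ≤1 x y with x ≟ y
... | yes x≡y = ≤-reflexive (δ-≡ x≡y)
... | no  x≢y = subst (_≤ 1) (sym (δ-≢ x≢y)) z≤n

δ≡1⇒≡ : {x y : ℕ} → δ x y ≡ 1 → x ≡ y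
δ≡1⇒≡ {x} {y} e with x ≟ y
... | yes x≡y = x≡y
... | no  x≢y with () ← trans (sym e) (δ-≢ x≢y)

δ≡0⇒≢ : {x y : ℕ} → δ x y ≡ 0 → x ≢ y
δ≡0⇒≢ e x≡y with () ← trans (sym e) (δ-≡ x≡y)

fixFromℕ : ℕ → List ℕ → ℕ
fixFromℕ i []      = 0
fixFromℕ i (a ∷ w) = δ a i + fixFromℕ (suc i) w

fixFrom-map-toℕ : {n : ℕ} (i : ℕ) (w : List (Fin n)) → fixFrom i w ≡ fixFromℕ i (map toℕ w)
fixFrom-map-toℕ i []      = refl
fixFrom-map-toℕ i (x ∷ w) = cong (δ (toℕ x) i +_) (fixFrom-map-toℕ (suc i) w)

dbl : ℕ → ℕ
dbl zero    = zero
dbl (suc n) = suc (suc (dbl n))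

half : ℕ → ℕ
half zero          = zero
half (suc zero)    = zero
half (suc (suc n)) = suc (half n)

half-dbl : (j : ℕ) → half (dbl j) ≡ j
half-dbl zero    = refl
half-dbl (suc j) = cong suc (half-dbl j)

half-suc-dbl : (j : ℕ) → half (suc (dbl j)) ≡ j
half-suc-dbl zero    = refl
half-suc-dbl (suc j) = cong suc (half-suc-dbl j)

dbl-half≤ : (n : ℕ) → dbl (half n) ≤ n
dbl-half≤ zero          = z≤n
dbl-half≤ (suc zero)    = z≤n
dbl-half≤ (suc (suc n)) = s≤s (s≤s (dbl-half≤ n))

even-or-odd : (n : ℕ) → n ≡ dbl (half n) ⊎ n ≡ suc (dbl (half n))
even-or-odd zero          = inj₁ refl
even-or-odd (suc zero)    = inj₂ refl
even-or-odd (suc (suc n)) with even-or-odd n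
... | inj₁ e = inj₁ (cong (suc ∘ suc) e)
... | inj₂ e = inj₂ (cong (suc ∘ suc) e)

dbl-mono-≤ : {j k : ℕ} → j ≤ k → dbl j ≤ dbl k
dbl-mono-≤ {zero}  _         = z≤n
dbl-mono-≤ {suc j} (s≤s j≤k) = s≤s (s≤s (dbl-mono-≤ j≤k))

suc-dbl-mono-< : {j k : ℕ} → j < k → suc (dbl j) < dbl k
suc-dbl-mono-< {zero}  {suc k} _         = s<s z<s
suc-dbl-mono-< {suc j} {suc k} (s<s j<k) = s<s (s<s (suc-dbl-mono-< j<k))

half-<-dbl : {n m : ℕ} → n < dbl m → half n < m
half-<-dbl {n} {m} n<2m with half n <? m
... | yes h<m = h<m
... | no  h≮m = ⊥-elim (<-irrefl refl (<-≤-trans n<2m (≤-trans (dbl-mono-≤ (≮⇒≥ h≮m)) (dbl-half≤ n))))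

sumBelow : (ℕ → ℕ) → ℕ → ℕ
sumBelow f zero    = 0
sumBelow f (suc n) = f 0 + sumBelow (f ∘ suc) n

sumBelow-cong : (n : ℕ) {f g : ℕ → ℕ} → (∀ {k} → k < n → f k ≡ g k) → sumBelow f n ≡ sumBelow g n
sumBelow-cong zero    f≗g = refl
sumBelow-cong (suc n) f≗g = cong₂ _+_ (f≗g z<s) (sumBelow-cong n (f≗g ∘ s<s))

sumBelow-const1 : (n : ℕ) → sumBelow (λ _ → 1) n ≡ n
sumBelow-const1 zero    = refl
sumBelow-const1 (suc n) = cong suc (sumBelow-const1 n)

sumBelow-+ : (p q : ℕ) (f : ℕ → ℕ) → sumBelow f (p + q) ≡ sumBelow f p + sumBelow (λ k → f (p + k)) q
sumBelow-+ zero    q f = refl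
sumBelow-+ (suc p) q f = trans (cong (f 0 +_) (sumBelow-+ p q (f ∘ suc))) (sym (+-assoc (f 0) _ _))

sumBelow-dbl : (m : ℕ) (f : ℕ → ℕ) → sumBelow f (dbl m) ≡ sumBelow (λ j → f (dbl j) + f (suc (dbl j))) m
sumBelow-dbl zero    f = refl
sumBelow-dbl (suc m) f =
  trans (sym (+-assoc (f 0) (f 1) _)) (cong (f 0 + f 1 +_) (sumBelow-dbl m (f ∘ suc ∘ suc)))

sumBelow-mono-≤ : (n : ℕ) {f g : ℕ → ℕ} → (∀ {k} → k < n → f k ≤ g k) → sumBelow f n ≤ sumBelow g n
sumBelow-mono-≤ zero    f≤g = z≤n
sumBelow-mono-≤ (suc n) f≤g = +-mono-≤ (f≤g z<s) (sumBelow-mono-≤ n (f≤g ∘ s<s))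

+-tight : {a b c d : ℕ} → a ≤ c → b ≤ d → a + b ≡ c + d → a ≡ c × b ≡ d
+-tight {a} {b} {c} {d} a≤c b≤d e = a≡c , +-cancelˡ-≡ a _ _ (trans e (cong (_+ d) (sym a≡c)))
  where
  a≡c : a ≡ c
  a≡c = ≤-antisym a≤c (+-cancelʳ-≤ d c a (subst (_≤ a + d) e (+-monoʳ-≤ a b≤d)))

sumBelow-tight : (n : ℕ) {f g : ℕ → ℕ} → (∀ {k} → k < n → f k ≤ g k) →
  sumBelow f n ≡ sumBelow g n → ∀ {k} → k < n → f k ≡ g k
sumBelow-tight (suc n) {f} {g} f≤g e = tight-at
  where
  tight = +-tight (f≤g z<s) (sumBelow-mono-≤ n (f≤g ∘ s<s)) e
  tight-at : ∀ {k} → k < suc n → f k ≡ g k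
  tight-at {zero}  _         = proj₁ tight
  tight-at {suc k} (s<s k<n) = sumBelow-tight n (f≤g ∘ s<s) (proj₂ tight) k<n

sumBelow-≡0⁻ : (n : ℕ) {f : ℕ → ℕ} → sumBelow f n ≡ 0 → ∀ {k} → k < n → f k ≡ 0
sumBelow-≡0⁻ (suc n) {f} e {zero}  _         = m+n≡0⇒m≡0 (f 0) e
sumBelow-≡0⁻ (suc n) {f} e {suc k} (s<s k<n) = sumBelow-≡0⁻ n (m+n≡0⇒n≡0 (f 0) e) k<n

sumBelow-≡0⁺ : (n : ℕ) {f : ℕ → ℕ} → (∀ {k} → k < n → f k ≡ 0) → sumBelow f n ≡ 0
sumBelow-≡0⁺ zero    f≡0 = refl
sumBelow-≡0⁺ (suc n) f≡0 = cong₂ _+_ (f≡0 z<s) (sumBelow-≡0⁺ n (f≡0 ∘ s<s))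

fixFromℕ-applyUpTo : (n i : ℕ) (a : ℕ → ℕ) →
  fixFromℕ i (applyUpTo a n) ≡ sumBelow (λ k → δ (a k) (i + k)) n
fixFromℕ-applyUpTo zero    i a = refl
fixFromℕ-applyUpTo (suc n) i a = cong₂ _+_ (cong (δ (a 0)) (sym (+-identityʳ i)))
  (trans (fixFromℕ-applyUpTo n (suc i) (a ∘ suc))
    (sumBelow-cong n (λ {k} _ → cong (δ (a (suc k))) (sym (+-suc i k)))))

-- s = 0 yields the alternating and s = 1 the reverse alternating permutations.
startsDown : ℕ → Bool
startsDown zero    = true
startsDown (suc _) = false

stepAt-dbl : (b : Bool) (j : ℕ) → stepAt b (dbl j) ≡ b
stepAt-dbl b     zero    = refl
stepAt-dbl true  (suc j) = stepAt-dbl true j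
stepAt-dbl false (suc j) = stepAt-dbl false j

stepAt-pair-first : (s : ℕ) → s ≤ 1 → (j : ℕ) → stepAt (startsDown s) (s + dbl j) ≡ true
stepAt-pair-first zero       _ j = stepAt-dbl true j
stepAt-pair-first (suc zero) _ j = stepAt-dbl true j
stepAt-pair-first (suc (suc _)) (s≤s ())

stepAt-pair-second : (s : ℕ) → s ≤ 1 → (j : ℕ) → stepAt (startsDown s) (s + suc (dbl j)) ≡ false
stepAt-pair-second zero       _ j = stepAt-dbl false j
stepAt-pair-second (suc zero) _ j = stepAt-dbl false j
stepAt-pair-second (suc (suc _)) (s≤s ())

stepAt-prefix : (s : ℕ) → s ≤ 1 → {k : ℕ} → k < s → stepAt (startsDown s) k ≡ false
stepAt-prefix (suc zero)    _         {zero}  _         = refl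
stepAt-prefix (suc zero)    _         {suc k} (s<s ())
stepAt-prefix (suc (suc _)) (s≤s ())

record IsPermutation (n : ℕ) (a : ℕ → ℕ) : Set where
  field
    bounded   : ∀ {i} → i < n → a i < n
    injective : InjectiveBelow n a

fixedPointCount : ℕ → (ℕ → ℕ) → ℕ
fixedPointCount n a = sumBelow (λ i → δ (a i) i) n

record IsDerangement (n : ℕ) (σ : ℕ → ℕ) : Set where
  field
    isPermutation : IsPermutation n σ
    fixedPointFree : ∀ {i} → i < n → σ i ≢ i
  open IsPermutation isPermutation public

if-dec-elim : {A : Set} {x y : ℕ} (P : ℕ → Set) (a? : Dec A) →
  (A → P x) → (¬ A → P y) → P (if does a? then x else y)
if-dec-elim P (yes a) on-yes on-no = on-yes a
if-dec-elim P (no ¬a) on-yes on-no = on-no ¬a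

fromℕs : (n : ℕ) → List ℕ → List (Fin n)
fromℕs n []       = []
fromℕs n (x ∷ xs) with x <? n
... | yes x<n = fromℕ< x<n ∷ fromℕs n xs
... | no  _   = fromℕs n xs

map-toℕ-fromℕs : (n : ℕ) {xs : List ℕ} → All (_< n) xs → map toℕ (fromℕs n xs) ≡ xs
map-toℕ-fromℕs n {[]}     []            = refl
map-toℕ-fromℕs n {x ∷ xs} (x<n ∷ xs<n) with x <? n
... | yes x<n′ = cong₂ _∷_ (toℕ-fromℕ< x<n′) (map-toℕ-fromℕs n xs<n)
... | no  x≮n  = ⊥-elim (x≮n x<n)

All-<-map-toℕ : {n : ℕ} (w : List (Fin n)) → All (_< n) (map toℕ w)
All-<-map-toℕ []      = []
All-<-map-toℕ (x ∷ w) = toℕ<n x ∷ All-<-map-toℕ w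

seq : {n : ℕ} → List (Fin n) → ℕ → ℕ
seq w = nth (map toℕ w)

word : (n : ℕ) → (ℕ → ℕ) → List (Fin n)
word n a = fromℕs n (applyUpTo a n)

module _ {n : ℕ} {a : ℕ → ℕ} (a-perm : IsPermutation n a) where
  open IsPermutation a-perm

  map-toℕ-word : map toℕ (word n a) ≡ applyUpTo a n
  map-toℕ-word = map-toℕ-fromℕs n (All.applyUpTo⁺₁ a n bounded)

  word-∈-perms : word n a ∈ perms n
  word-∈-perms = ∈-perms⁺
    (trans (sym (length-map toℕ (word n a))) (trans (cong length map-toℕ-word) (length-applyUpTo a n)))
    (Unique.map⁻ (subst Unique (sym map-toℕ-word) (Unique-applyUpTo⁺ n a injective)))

  seq-word : {k : ℕ} → k < n → seq (word n a) k ≡ a k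
  seq-word {k} k<n = trans (cong (λ xs → nth xs k) map-toℕ-word) (nth-applyUpTo a n k<n)

module _ {n : ℕ} {w : List (Fin n)} (w∈perms : w ∈ perms n) where

  applyUpTo-seq : applyUpTo (seq w) n ≡ map toℕ w
  applyUpTo-seq = subst (λ k → applyUpTo (seq w) k ≡ map toℕ w)
    (trans (length-map toℕ w) (proj₁ (∈-perms⁻ w∈perms))) (applyUpTo-nth (map toℕ w))

  seq-isPermutation : IsPermutation n (seq w)
  seq-isPermutation = record
    { bounded   = All.applyUpTo⁻ (seq w) n (subst (All (_< n)) (sym applyUpTo-seq) (All-<-map-toℕ w))
    ; injective = Unique-applyUpTo⁻ n (seq w)
        (subst Unique (sym applyUpTo-seq) (Unique.map⁺ toℕ-injective (proj₂ (∈-perms⁻ w∈perms))))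
    }

  word-seq : word n (seq w) ≡ w
  word-seq = map-injective toℕ-injective (trans (map-toℕ-word seq-isPermutation) applyUpTo-seq)

module _ {n : ℕ} {w : List (Fin n)} {a : ℕ → ℕ} (w≡a : map toℕ w ≡ applyUpTo a n) where

  fixedPoints-sequence : fixedPoints w ≡ fixedPointCount n a
  fixedPoints-sequence = trans (fixFrom-map-toℕ 0 w) (trans (cong (fixFromℕ 0) w≡a) (fixFromℕ-applyUpTo n 0 a))

  zigzag-sequence : (b : Bool) → zigzag b w ≡ zigzagℕ b (applyUpTo a n)
  zigzag-sequence b = trans (zigzag-map-toℕ b w) (cong (zigzagℕ b) w≡a)

word-cong : (n : ℕ) {a b : ℕ → ℕ} → (∀ {k} → k < n → a k ≡ b k) → word n a ≡ word n b
word-cong n a≗b = cong (fromℕs n) (applyUpTo-cong n a≗b)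

isDerangementWord? : {n : ℕ} (w : List (Fin n)) → Dec (fixedPoints w ≡ 0)
isDerangementWord? w = fixedPoints w ≟ 0

Derangements : (n : ℕ) → List (List (Fin n))
Derangements n = filter isDerangementWord? (perms n)

module _ {n : ℕ} where

  ∈-Derangements⁻ : {τ : List (Fin n)} → τ ∈ Derangements n → τ ∈ perms n × IsDerangement n (seq τ)
  ∈-Derangements⁻ {τ} τ∈ with τ∈perms , no-fixed ← ∈-filter⁻ isDerangementWord? {xs = perms n} τ∈ =
    τ∈perms , record
      { isPermutation  = seq-isPermutation τ∈perms
      ; fixedPointFree = δ≡0⇒≢ ∘ sumBelow-≡0⁻ n
          (trans (sym (fixedPoints-sequence (sym (applyUpTo-seq τ∈perms)))) no-fixed)
      }

  word-∈-Derangements : {σ : ℕ → ℕ} → IsDerangement n σ → word n σ ∈ Derangements n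
  word-∈-Derangements {σ} σ-der = ∈-filter⁺ isDerangementWord? (word-∈-perms isPermutation)
    (trans (fixedPoints-sequence (map-toℕ-word isPermutation)) (sumBelow-≡0⁺ n (δ-≢ ∘ fixedPointFree)))
    where open IsDerangement σ-der

module Blocks (s e m : ℕ) (s≤1 : s ≤ 1) (e≤1 : e ≤ 1) where

  pos₀ pos₁ : ℕ → ℕ
  pos₀ j = s + dbl j
  pos₁ j = s + suc (dbl j)

  tailPos : ℕ → ℕ
  tailPos t = s + (dbl m + t)

  tailStart size : ℕ
  tailStart = s + dbl m
  size      = s + (dbl m + e)

  pairOf : ℕ → ℕ
  pairOf x = half (x ∸ s)

  pairOf-pos₀ : (j : ℕ) → pairOf (pos₀ j) ≡ j
  pairOf-pos₀ j = trans (cong half (m+n∸m≡n s (dbl j))) (half-dbl j)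

  pairOf-pos₁ : (j : ℕ) → pairOf (pos₁ j) ≡ j
  pairOf-pos₁ j = trans (cong half (m+n∸m≡n s (suc (dbl j)))) (half-suc-dbl j)

  pos₁≡suc-pos₀ : (j : ℕ) → pos₁ j ≡ suc (pos₀ j)
  pos₁≡suc-pos₀ j = +-suc s (dbl j)

  suc-pos₁≡pos₀-suc : (j : ℕ) → suc (pos₁ j) ≡ pos₀ (suc j)
  suc-pos₁≡pos₀-suc j = sym (+-suc s (suc (dbl j)))

  pos₀<pos₁ : (j : ℕ) → pos₀ j < pos₁ j
  pos₀<pos₁ j = ≤-reflexive (sym (pos₁≡suc-pos₀ j))

  pos₀≢pos₁ : (j : ℕ) → pos₀ j ≢ pos₁ j
  pos₀≢pos₁ j = <⇒≢ (pos₀<pos₁ j)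

  pos₁<pos₀ : {j k : ℕ} → j < k → pos₁ j < pos₀ k
  pos₁<pos₀ j<k = +-monoʳ-< s (suc-dbl-mono-< j<k)

  pos₀-mono-≤ : {j k : ℕ} → j ≤ k → pos₀ j ≤ pos₀ k
  pos₀-mono-≤ j≤k = +-monoʳ-≤ s (dbl-mono-≤ j≤k)

  pos₁-mono-≤ : {j k : ℕ} → j ≤ k → pos₁ j ≤ pos₁ k
  pos₁-mono-≤ j≤k = +-monoʳ-≤ s (s≤s (dbl-mono-≤ j≤k))

  s≤pos₀ : (j : ℕ) → s ≤ pos₀ j
  s≤pos₀ j = m≤m+n s (dbl j)

  pos₁<tailStart : {j : ℕ} → j < m → pos₁ j < tailStart
  pos₁<tailStart = pos₁<pos₀

  tailStart≤tailPos : (t : ℕ) → tailStart ≤ tailPos t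
  tailStart≤tailPos t = +-monoʳ-≤ s (m≤m+n (dbl m) t)

  tailStart≤size : tailStart ≤ size
  tailStart≤size = tailStart≤tailPos e

  pos₁<size : {j : ℕ} → j < m → pos₁ j < size
  pos₁<size j<m = <-≤-trans (pos₁<tailStart j<m) tailStart≤size

  pos₀<size : {j : ℕ} → j < m → pos₀ j < size
  pos₀<size j<m = <-trans (pos₀<pos₁ _) (pos₁<size j<m)

  pairOf-< : {x : ℕ} → s ≤ x → x < tailStart → pairOf x < m
  pairOf-< {x} s≤x x<T = half-<-dbl (+-cancelˡ-< s _ _ (subst (_< tailStart) (sym (m+[n∸m]≡n s≤x)) x<T))

  data Position (x : ℕ) : Set where
    inPrefix : x < s → Position x
    inPair₀  : (j : ℕ) → j < m → x ≡ pos₀ j → Position x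
    inPair₁  : (j : ℕ) → j < m → x ≡ pos₁ j → Position x
    inTail   : (t : ℕ) → t < e → x ≡ tailPos t → Position x

  position : (x : ℕ) → x < size → Position x
  position x x<size with x <? s
  ... | yes x<s = inPrefix x<s
  ... | no  x≮s = beyond-prefix (x ∸ s) (sym (m+[n∸m]≡n (≮⇒≥ x≮s)))
    where
    beyond-prefix : (r : ℕ) → x ≡ s + r → Position x
    beyond-prefix r x≡ with r <? dbl m | even-or-odd r
    ... | yes r<2m | inj₁ even = inPair₀ (half r) (half-<-dbl r<2m) (trans x≡ (cong (s +_) even))
    ... | yes r<2m | inj₂ odd  = inPair₁ (half r) (half-<-dbl r<2m) (trans x≡ (cong (s +_) odd))
    ... | no  r≮2m | _         = inTail t t<e x≡tailPos
      where
      t = r ∸ dbl m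
      x≡tailPos : x ≡ tailPos t
      x≡tailPos = trans x≡ (cong (s +_) (sym (m+[n∸m]≡n (≮⇒≥ r≮2m))))
      t<e : t < e
      t<e = +-cancelˡ-< (dbl m) _ _ (+-cancelˡ-< s _ _ (subst (_< size) x≡tailPos x<size))

  pairFixed : (ℕ → ℕ) → ℕ → ℕ
  pairFixed a j = δ (a (pos₀ j)) (pos₀ j) + δ (a (pos₁ j)) (pos₁ j)

  fixedPointCount-blocks : (a : ℕ → ℕ) → fixedPointCount size a ≡
    sumBelow (λ k → δ (a k) k) s + (sumBelow (pairFixed a) m + sumBelow (λ t → δ (a (tailPos t)) (tailPos t)) e)
  fixedPointCount-blocks a = begin
    fixedPointCount size a
      ≡⟨ sumBelow-+ s (dbl m + e) _ ⟩
    sumBelow f s + sumBelow (λ k → f (s + k)) (dbl m + e)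
      ≡⟨ cong (sumBelow f s +_) (sumBelow-+ (dbl m) e _) ⟩
    sumBelow f s + (sumBelow (λ k → f (s + k)) (dbl m) + sumBelow (f ∘ tailPos) e)
      ≡⟨ cong (λ p → sumBelow f s + (p + sumBelow (f ∘ tailPos) e)) (sumBelow-dbl m _) ⟩
    sumBelow f s + (sumBelow (pairFixed a) m + sumBelow (f ∘ tailPos) e) ∎
    where
    open ≡-Reasoning
    f : ℕ → ℕ
    f k = δ (a k) k

  record IsUpDown (a : ℕ → ℕ) : Set where
    field
      isPermutation : IsPermutation size a
      isZigzag      : Zigzag (startsDown s) size a
      fixedPoints≡  : fixedPointCount size a ≡ s + (m + e)
    open IsPermutation isPermutation public

  module FromDerangement (σ : ℕ → ℕ) where

    mover : ℕ → ℕ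
    mover j = if does (j <? σ j) then pos₀ j else pos₁ j

    mover-cases : (j : ℕ) → (j < σ j × mover j ≡ pos₀ j) ⊎ (j ≮ σ j × mover j ≡ pos₁ j)
    mover-cases j = if-dec-elim (λ x → (j < σ j × x ≡ pos₀ j) ⊎ (j ≮ σ j × x ≡ pos₁ j)) (j <? σ j)
      (λ j<σj → inj₁ (j<σj , refl)) (λ j≮σj → inj₂ (j≮σj , refl))

    mover-< : {j : ℕ} → j < σ j → mover j ≡ pos₀ j
    mover-< {j} j<σj with mover-cases j
    ... | inj₁ (_ , e)    = e
    ... | inj₂ (j≮σj , _) = ⊥-elim (j≮σj j<σj)

    mover-≮ : {j : ℕ} → j ≮ σ j → mover j ≡ pos₁ j
    mover-≮ {j} j≮σj with mover-cases j
    ... | inj₁ (j<σj , _) = ⊥-elim (j≮σj j<σj)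
    ... | inj₂ (_ , e)    = e

    pairOf-mover : (j : ℕ) → pairOf (mover j) ≡ j
    pairOf-mover j with mover-cases j
    ... | inj₁ (_ , e) = trans (cong pairOf e) (pairOf-pos₀ j)
    ... | inj₂ (_ , e) = trans (cong pairOf e) (pairOf-pos₁ j)

    pos₀≤mover : (j : ℕ) → pos₀ j ≤ mover j
    pos₀≤mover j with mover-cases j
    ... | inj₁ (_ , e) = ≤-reflexive (sym e)
    ... | inj₂ (_ , e) = subst (pos₀ j ≤_) (sym e) (<⇒≤ (pos₀<pos₁ j))

    mover≤pos₁ : (j : ℕ) → mover j ≤ pos₁ j
    mover≤pos₁ j with mover-cases j
    ... | inj₁ (_ , e) = subst (_≤ pos₁ j) (sym e) (<⇒≤ (pos₀<pos₁ j))
    ... | inj₂ (_ , e) = ≤-reflexive e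

    mover≢pos : {j k : ℕ} → j ≢ k → mover j ≢ pos₀ k × mover j ≢ pos₁ k
    mover≢pos {j} {k} j≢k =
        (λ e → j≢k (trans (sym (pairOf-mover j)) (trans (cong pairOf e) (pairOf-pos₀ k))))
      , (λ e → j≢k (trans (sym (pairOf-mover j)) (trans (cong pairOf e) (pairOf-pos₁ k))))

    IsMover : ℕ → Set
    IsMover x = s ≤ x × x < tailStart × x ≡ mover (pairOf x)

    isMover? : (x : ℕ) → Dec (IsMover x)
    isMover? x = (s ≤? x) ×-dec (x <? tailStart) ×-dec (x ≟ mover (pairOf x))

    isMover-mover : {j : ℕ} → j < m → IsMover (mover j)
    isMover-mover {j} j<m =
        ≤-trans (s≤pos₀ j) (pos₀≤mover j)
      , ≤-<-trans (mover≤pos₁ j) (pos₁<tailStart j<m)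
      , cong mover (sym (pairOf-mover j))

    perm : ℕ → ℕ
    perm x = if does (isMover? x) then mover (σ (pairOf x)) else x

    perm-isMover : {x : ℕ} → IsMover x → perm x ≡ mover (σ (pairOf x))
    perm-isMover {x} p = if-dec-elim (_≡ mover (σ (pairOf x))) (isMover? x) (λ _ → refl) (λ ¬p → ⊥-elim (¬p p))

    perm-¬isMover : {x : ℕ} → ¬ IsMover x → perm x ≡ x
    perm-¬isMover {x} ¬p = if-dec-elim (_≡ x) (isMover? x) (λ p → ⊥-elim (¬p p)) (λ _ → refl)

    perm-mover : {j : ℕ} → j < m → perm (mover j) ≡ mover (σ j)
    perm-mover {j} j<m = trans (perm-isMover (isMover-mover j<m)) (cong (mover ∘ σ) (pairOf-mover j))

    perm-non-mover : (x : ℕ) → x ≢ mover (pairOf x) → perm x ≡ x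
    perm-non-mover x x≢ = perm-¬isMover (λ (_ , _ , x≡) → x≢ x≡)

    perm-prefix : {x : ℕ} → x < s → perm x ≡ x
    perm-prefix x<s = perm-¬isMover (λ (s≤x , _ , _) → <⇒≱ x<s s≤x)

    perm-tail : {x : ℕ} → tailStart ≤ x → perm x ≡ x
    perm-tail T≤x = perm-¬isMover (λ (_ , x<T , _) → <⇒≱ x<T T≤x)

    module _ (σ-der : IsDerangement m σ) where
      open IsDerangement σ-der renaming (bounded to σ-bounded; injective to σ-injective)

      σ-<-of-≮ : {j : ℕ} → j < m → j ≮ σ j → σ j < j
      σ-<-of-≮ {j} j<m j≮σj = ≤∧≢⇒< (≮⇒≥ j≮σj) (fixedPointFree j<m)

      perm-pos₀-< : {j : ℕ} → j < m → j < σ j → perm (pos₀ j) ≡ mover (σ j)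
      perm-pos₀-< j<m j<σj = trans (cong perm (sym (mover-< j<σj))) (perm-mover j<m)

      perm-pos₁-< : {j : ℕ} → j < σ j → perm (pos₁ j) ≡ pos₁ j
      perm-pos₁-< {j} j<σj = perm-non-mover (pos₁ j)
        (λ e → pos₀≢pos₁ j (sym (trans e (trans (cong mover (pairOf-pos₁ j)) (mover-< j<σj)))))

      perm-pos₀-≮ : {j : ℕ} → j ≮ σ j → perm (pos₀ j) ≡ pos₀ j
      perm-pos₀-≮ {j} j≮σj = perm-non-mover (pos₀ j)
        (λ e → pos₀≢pos₁ j (trans e (trans (cong mover (pairOf-pos₀ j)) (mover-≮ j≮σj))))

      perm-pos₁-≮ : {j : ℕ} → j < m → j ≮ σ j → perm (pos₁ j) ≡ mover (σ j)
      perm-pos₁-≮ j<m j≮σj = trans (cong perm (sym (mover-≮ j≮σj))) (perm-mover j<m)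

      pos₀≤perm-pos₀ : {j : ℕ} → j ≤ m → pos₀ j ≤ perm (pos₀ j)
      pos₀≤perm-pos₀ {j} j≤m with m≤n⇒m<n∨m≡n j≤m
      ... | inj₂ refl = ≤-reflexive (sym (perm-tail ≤-refl))
      ... | inj₁ j<m with j <? σ j
      ...   | yes j<σj = subst (pos₀ j ≤_) (sym (perm-pos₀-< j<m j<σj))
                (≤-trans (<⇒≤ (<-trans (pos₀<pos₁ j) (pos₁<pos₀ j<σj))) (pos₀≤mover (σ j)))
      ...   | no  j≮σj = ≤-reflexive (sym (perm-pos₀-≮ j≮σj))

      perm-pos₁≤pos₁ : {j : ℕ} → j < m → perm (pos₁ j) ≤ pos₁ j
      perm-pos₁≤pos₁ {j} j<m with j <? σ j
      ... | yes j<σj = ≤-reflexive (perm-pos₁-< j<σj)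
      ... | no  j≮σj = subst (_≤ pos₁ j) (sym (perm-pos₁-≮ j<m j≮σj))
              (≤-trans (mover≤pos₁ (σ j)) (<⇒≤ (<-trans (pos₁<pos₀ (σ-<-of-≮ j<m j≮σj)) (pos₀<pos₁ j))))

      perm-pair-descent : {j : ℕ} → j < m → perm (pos₁ j) < perm (pos₀ j)
      perm-pair-descent {j} j<m with j <? σ j
      ... | yes j<σj = subst₂ _<_ (sym (perm-pos₁-< j<σj)) (sym (perm-pos₀-< j<m j<σj))
              (<-≤-trans (pos₁<pos₀ j<σj) (pos₀≤mover (σ j)))
      ... | no  j≮σj = subst₂ _<_ (sym (perm-pos₁-≮ j<m j≮σj)) (sym (perm-pos₀-≮ j≮σj))
              (≤-<-trans (mover≤pos₁ (σ j)) (pos₁<pos₀ (σ-<-of-≮ j<m j≮σj)))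

      perm-pair-fixedPoints : {j : ℕ} → j < m → δ (perm (pos₀ j)) (pos₀ j) + δ (perm (pos₁ j)) (pos₁ j) ≡ 1
      perm-pair-fixedPoints {j} j<m with j <? σ j
      ... | yes j<σj rewrite perm-pos₀-< j<m j<σj | perm-pos₁-< j<σj
                           | δ-≢ (proj₁ (mover≢pos (fixedPointFree j<m))) | δ-refl (pos₁ j) = refl
      ... | no  j≮σj rewrite perm-pos₀-≮ j≮σj | perm-pos₁-≮ j<m j≮σj
                           | δ-≢ (proj₂ (mover≢pos (fixedPointFree j<m))) | δ-refl (pos₀ j) = refl

      isMover-perm : {x : ℕ} → IsMover x → IsMover (perm x)
      isMover-perm p@(s≤x , x<T , _) =
        subst IsMover (sym (perm-isMover p)) (isMover-mover (σ-bounded (pairOf-< s≤x x<T)))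

      perm-bounded : {x : ℕ} → x < size → perm x < size
      perm-bounded {x} x<size with isMover? x
      ... | yes p = <-≤-trans (proj₁ (proj₂ (isMover-perm p))) tailStart≤size
      ... | no ¬p = subst (_< size) (sym (perm-¬isMover ¬p)) x<size

      perm-injective : InjectiveBelow size perm
      perm-injective {x} {y} _ _ e with isMover? x | isMover? y
      ... | yes px@(s≤x , x<T , x≡) | yes py@(s≤y , y<T , y≡) = begin
        x                   ≡⟨ x≡ ⟩
        mover (pairOf x)    ≡⟨ cong mover (σ-injective (pairOf-< s≤x x<T) (pairOf-< s≤y y<T) σx≡σy) ⟩
        mover (pairOf y)    ≡⟨ sym y≡ ⟩
        y                   ∎
        where
        open ≡-Reasoning
        σx≡σy : σ (pairOf x) ≡ σ (pairOf y)
        σx≡σy = trans (sym (pairOf-mover _))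
          (trans (cong pairOf (trans (sym (perm-isMover px)) (trans e (perm-isMover py)))) (pairOf-mover _))
      ... | yes px | no ¬py = ⊥-elim (¬py (subst IsMover (trans e (perm-¬isMover ¬py)) (isMover-perm px)))
      ... | no ¬px | yes py = ⊥-elim (¬px (subst IsMover (trans (sym e) (perm-¬isMover ¬px)) (isMover-perm py)))
      ... | no ¬px | no ¬py = trans (sym (perm-¬isMover ¬px)) (trans e (perm-¬isMover ¬py))

      perm-zigzag : Zigzag (startsDown s) size perm
      perm-zigzag {k} 1+k<size with position k (<-trans (n<1+n k) 1+k<size)
      ... | inPrefix k<s = Step-up (stepAt-prefix s s≤1 k<s)
        (subst (_< perm (suc k)) (sym (perm-prefix k<s)) (<-≤-trans (n<1+n k)
          (subst (λ x → x ≤ perm x) (sym 1+k≡pos₀0) (pos₀≤perm-pos₀ z≤n))))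
        where
        1+k≡pos₀0 : suc k ≡ pos₀ 0
        1+k≡pos₀0 = trans (≤-antisym k<s (≤-trans s≤1 (s≤s z≤n))) (sym (+-identityʳ s))
      ... | inPair₀ j j<m refl = Step-down (stepAt-pair-first s s≤1 j)
        (subst (λ x → perm x < perm (pos₀ j)) (pos₁≡suc-pos₀ j) (perm-pair-descent j<m))
      ... | inPair₁ j j<m refl = Step-up (stepAt-pair-second s s≤1 j)
        (≤-<-trans (perm-pos₁≤pos₁ j<m) (<-≤-trans (n<1+n (pos₁ j))
          (subst (λ x → x ≤ perm x) (sym (suc-pos₁≡pos₀-suc j)) (pos₀≤perm-pos₀ j<m))))
      ... | inTail t t<e refl = ⊥-elim (<⇒≱ (≤-trans 1+t<e e≤1) (s≤s z≤n))
        where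
        1+t<e : suc t < e
        1+t<e = +-cancelˡ-< (dbl m) _ _ (+-cancelˡ-< s _ _
          (subst (_< size) (trans (sym (+-suc s _)) (cong (s +_) (sym (+-suc (dbl m) t)))) 1+k<size))

      perm-fixedPointCount : fixedPointCount size perm ≡ s + (m + e)
      perm-fixedPointCount = trans (fixedPointCount-blocks perm)
        (cong₂ _+_ (all-one s prefix-fixed) (cong₂ _+_ (all-one m perm-pair-fixedPoints) (all-one e tail-fixed)))
        where
        all-one : (n : ℕ) {f : ℕ → ℕ} → (∀ {k} → k < n → f k ≡ 1) → sumBelow f n ≡ n
        all-one n f≡1 = trans (sumBelow-cong n f≡1) (sumBelow-const1 n)
        prefix-fixed : ∀ {k} → k < s → δ (perm k) k ≡ 1
        prefix-fixed {k} k<s = subst (λ x → δ x k ≡ 1) (sym (perm-prefix k<s)) (δ-refl k)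
        tail-fixed : ∀ {t} → t < e → δ (perm (tailPos t)) (tailPos t) ≡ 1
        tail-fixed {t} _ =
          subst (λ x → δ x (tailPos t) ≡ 1) (sym (perm-tail (tailStart≤tailPos t))) (δ-refl (tailPos t))

      perm-isUpDown : IsUpDown perm
      perm-isUpDown = record
        { isPermutation = record { bounded = perm-bounded ; injective = perm-injective }
        ; isZigzag      = perm-zigzag
        ; fixedPoints≡  = perm-fixedPointCount
        }

  module FromUpDown (a : ℕ → ℕ) where

    moverOf : ℕ → ℕ
    moverOf j = if does (a (pos₀ j) ≟ pos₀ j) then pos₁ j else pos₀ j

    moverOf-cases : (j : ℕ) →
      (a (pos₀ j) ≡ pos₀ j × moverOf j ≡ pos₁ j) ⊎ (a (pos₀ j) ≢ pos₀ j × moverOf j ≡ pos₀ j)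
    moverOf-cases j =
      if-dec-elim (λ x → (a (pos₀ j) ≡ pos₀ j × x ≡ pos₁ j) ⊎ (a (pos₀ j) ≢ pos₀ j × x ≡ pos₀ j))
        (a (pos₀ j) ≟ pos₀ j) (λ p → inj₁ (p , refl)) (λ p → inj₂ (p , refl))

    pairOf-moverOf : (j : ℕ) → pairOf (moverOf j) ≡ j
    pairOf-moverOf j with moverOf-cases j
    ... | inj₁ (_ , e) = trans (cong pairOf e) (pairOf-pos₁ j)
    ... | inj₂ (_ , e) = trans (cong pairOf e) (pairOf-pos₀ j)

    pos₀≤moverOf : (j : ℕ) → pos₀ j ≤ moverOf j
    pos₀≤moverOf j with moverOf-cases j
    ... | inj₁ (_ , e) = subst (pos₀ j ≤_) (sym e) (<⇒≤ (pos₀<pos₁ j))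
    ... | inj₂ (_ , e) = ≤-reflexive (sym e)

    moverOf≤pos₁ : (j : ℕ) → moverOf j ≤ pos₁ j
    moverOf≤pos₁ j with moverOf-cases j
    ... | inj₁ (_ , e) = ≤-reflexive e
    ... | inj₂ (_ , e) = subst (_≤ pos₁ j) (sym e) (<⇒≤ (pos₀<pos₁ j))

    moverOf<size : {j : ℕ} → j < m → moverOf j < size
    moverOf<size j<m = ≤-<-trans (moverOf≤pos₁ _) (pos₁<size j<m)

    derangement : ℕ → ℕ
    derangement j = pairOf (a (moverOf j))

    module _ (a-ud : IsUpDown a) where
      open IsUpDown a-ud renaming (bounded to a-bounded; injective to a-injective)

      pair-descent : {j : ℕ} → j < m → a (pos₁ j) < a (pos₀ j)
      pair-descent {j} j<m = subst (λ x → a x < a (pos₀ j)) (sym (pos₁≡suc-pos₀ j))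
        (subst (λ b → Step b (a (pos₀ j)) (a (suc (pos₀ j)))) (stepAt-pair-first s s≤1 j)
          (isZigzag (subst (_< size) (pos₁≡suc-pos₀ j) (pos₁<size j<m))))

      pairFixed≤1 : {j : ℕ} → j < m → pairFixed a j ≤ 1
      pairFixed≤1 {j} j<m with a (pos₀ j) ≟ pos₀ j | a (pos₁ j) ≟ pos₁ j
      ... | yes p | yes q = ⊥-elim (<-asym (pos₀<pos₁ j) (subst₂ _<_ q p (pair-descent j<m)))
      ... | yes _ | no  q rewrite δ-≢ q = ≤-trans (≤-reflexive (+-identityʳ _)) (δ≤1 (a (pos₀ j)) (pos₀ j))
      ... | no  p | _     rewrite δ-≢ p = δ≤1 (a (pos₁ j)) (pos₁ j)

      private
        prefix≤ : ∀ {k} → k < s → δ (a k) k ≤ 1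
        prefix≤ {k} _ = δ≤1 (a k) k
        tail≤ : ∀ {t} → t < e → δ (a (tailPos t)) (tailPos t) ≤ 1
        tail≤ {t} _ = δ≤1 (a (tailPos t)) (tailPos t)

        -- Each block contributes at most its length, and the total s + m + e is attained.
        tight = +-tight (sumBelow-mono-≤ s prefix≤)
          (+-mono-≤ (sumBelow-mono-≤ m pairFixed≤1) (sumBelow-mono-≤ e tail≤))
          (trans (sym (fixedPointCount-blocks a)) (trans fixedPoints≡
            (sym (cong₂ _+_ (sumBelow-const1 s) (cong₂ _+_ (sumBelow-const1 m) (sumBelow-const1 e))))))
        tight-rest = +-tight (sumBelow-mono-≤ m pairFixed≤1) (sumBelow-mono-≤ e tail≤) (proj₂ tight)

      fixed-prefix : {k : ℕ} → k < s → a k ≡ k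
      fixed-prefix k<s = δ≡1⇒≡ (sumBelow-tight s prefix≤ (proj₁ tight) k<s)

      fixed-tail : {t : ℕ} → t < e → a (tailPos t) ≡ tailPos t
      fixed-tail t<e = δ≡1⇒≡ (sumBelow-tight e tail≤ (proj₂ tight-rest) t<e)

      pairFixed≡1 : {j : ℕ} → j < m → pairFixed a j ≡ 1
      pairFixed≡1 = sumBelow-tight m pairFixed≤1 (proj₁ tight-rest)

      exactly-one-fixed : {j : ℕ} → j < m →
        (a (pos₀ j) ≡ pos₀ j × a (pos₁ j) ≢ pos₁ j) ⊎ (a (pos₀ j) ≢ pos₀ j × a (pos₁ j) ≡ pos₁ j)
      exactly-one-fixed {j} j<m with a (pos₀ j) ≟ pos₀ j | a (pos₁ j) ≟ pos₁ j | pairFixed≡1 j<m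
      ... | yes p | yes q | e rewrite p | q | δ-refl (pos₀ j) | δ-refl (pos₁ j) with () ← e
      ... | yes p | no  q | _ = inj₁ (p , q)
      ... | no  p | yes q | _ = inj₂ (p , q)
      ... | no  p | no  q | e rewrite δ-≢ p | δ-≢ q with () ← e

      moverOf-moves : {j : ℕ} → j < m → a (moverOf j) ≢ moverOf j
      moverOf-moves {j} j<m with moverOf-cases j | exactly-one-fixed j<m
      ... | inj₁ (_ , e)    | inj₁ (_ , q) = subst (λ x → a x ≢ x) (sym e) q
      ... | inj₁ (p , _)    | inj₂ (¬p , _) = ⊥-elim (¬p p)
      ... | inj₂ (¬p , e)   | _             = subst (λ x → a x ≢ x) (sym e) ¬p

      fixed-in-pair : {j x : ℕ} → j < m → x ≡ pos₀ j ⊎ x ≡ pos₁ j → x ≢ moverOf j → a x ≡ x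
      fixed-in-pair {j} j<m (inj₁ refl) x≢ with moverOf-cases j
      ... | inj₁ (p , _) = p
      ... | inj₂ (_ , e) = ⊥-elim (x≢ (sym e))
      fixed-in-pair {j} j<m (inj₂ refl) x≢ with moverOf-cases j | exactly-one-fixed j<m
      ... | inj₁ (_ , e)  | _            = ⊥-elim (x≢ (sym e))
      ... | inj₂ _        | inj₂ (_ , q) = q
      ... | inj₂ (¬p , _) | inj₁ (p , _) = ⊥-elim (¬p p)

      moved-in-pair : {j y : ℕ} → j < m → y ≡ pos₀ j ⊎ y ≡ pos₁ j → a y ≢ y → y ≡ moverOf j
      moved-in-pair {j} {y} j<m y∈pair ay≢y with y ≟ moverOf j
      ... | yes y≡ = y≡
      ... | no  y≢ = ⊥-elim (ay≢y (fixed-in-pair j<m y∈pair y≢))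

      moved-is-mover : {x : ℕ} → x < size → a x ≢ x → pairOf x < m × x ≡ moverOf (pairOf x)
      moved-is-mover {x} x<size ax≢x with position x x<size
      ... | inPrefix x<s       = ⊥-elim (ax≢x (fixed-prefix x<s))
      ... | inTail t t<e refl  = ⊥-elim (ax≢x (fixed-tail t<e))
      ... | inPair₀ j j<m refl = subst (λ i → i < m × pos₀ j ≡ moverOf i) (sym (pairOf-pos₀ j))
                                   (j<m , moved-in-pair j<m (inj₁ refl) ax≢x)
      ... | inPair₁ j j<m refl = subst (λ i → i < m × pos₁ j ≡ moverOf i) (sym (pairOf-pos₁ j))
                                   (j<m , moved-in-pair j<m (inj₂ refl) ax≢x)

      mover-image : {j : ℕ} → j < m → derangement j < m × a (moverOf j) ≡ moverOf (derangement j)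
      mover-image {j} j<m = moved-is-mover (a-bounded (moverOf<size j<m))
        (λ e → moverOf-moves j<m (a-injective (a-bounded (moverOf<size j<m)) (moverOf<size j<m) e))

      derangement-isDerangement : IsDerangement m derangement
      derangement-isDerangement = record
        { isPermutation = record
          { bounded   = proj₁ ∘ mover-image
          ; injective = λ {j} {k} j<m k<m e → begin
              j                             ≡⟨ sym (pairOf-moverOf j) ⟩
              pairOf (moverOf j)            ≡⟨ cong pairOf (a-injective (moverOf<size j<m) (moverOf<size k<m)
                                                 (trans (proj₂ (mover-image j<m))
                                                   (trans (cong moverOf e) (sym (proj₂ (mover-image k<m)))))) ⟩
              pairOf (moverOf k)            ≡⟨ pairOf-moverOf k ⟩
              k                             ∎
          }
        ; fixedPointFree = λ j<m e → moverOf-moves j<m (trans (proj₂ (mover-image j<m)) (cong moverOf e))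
        }
        where open ≡-Reasoning

      open FromDerangement derangement using (mover; mover-cases; perm; perm-mover; perm-non-mover; perm-prefix; perm-tail)

      mover≡moverOf : {j : ℕ} → j < m → mover j ≡ moverOf j
      mover≡moverOf {j} j<m with mover-cases j | moverOf-cases j
      ... | inj₁ (_ , e₁) | inj₂ (_ , e₂) = trans e₁ (sym e₂)
      ... | inj₂ (_ , e₁) | inj₁ (_ , e₂) = trans e₁ (sym e₂)
      ... | inj₁ (j<σj , _) | inj₁ (p , e₂) = ⊥-elim (<⇒≱ image<pos₀ (begin
          pos₀ j                        ≤⟨ pos₀-mono-≤ (<⇒≤ j<σj) ⟩
          pos₀ (derangement j)          ≤⟨ pos₀≤moverOf (derangement j) ⟩
          moverOf (derangement j)       ≡⟨ sym (proj₂ (mover-image j<m)) ⟩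
          a (moverOf j)                 ∎))
        where
        open ≤-Reasoning
        image<pos₀ : a (moverOf j) < pos₀ j
        image<pos₀ = subst (λ x → a x < pos₀ j) (sym e₂) (subst (a (pos₁ j) <_) p (pair-descent j<m))
      ... | inj₂ (j≮σj , _) | inj₂ (¬p , e₂) = ⊥-elim (<⇒≱ pos₁<image (begin
          a (moverOf j)                 ≡⟨ proj₂ (mover-image j<m) ⟩
          moverOf (derangement j)       ≤⟨ moverOf≤pos₁ (derangement j) ⟩
          pos₁ (derangement j)          ≤⟨ pos₁-mono-≤ (≮⇒≥ j≮σj) ⟩
          pos₁ j                        ∎))
        where
        open ≤-Reasoning
        pos₁-fixed : a (pos₁ j) ≡ pos₁ j
        pos₁-fixed with exactly-one-fixed j<m
        ... | inj₁ (p , _) = ⊥-elim (¬p p)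
        ... | inj₂ (_ , q) = q
        pos₁<image : pos₁ j < a (moverOf j)
        pos₁<image = subst (_< a (moverOf j)) pos₁-fixed
          (subst (a (pos₁ j) <_) (cong a (sym e₂)) (pair-descent j<m))

      perm-in-pair : {j y : ℕ} → j < m → pairOf y ≡ j → y ≡ pos₀ j ⊎ y ≡ pos₁ j → perm y ≡ a y
      perm-in-pair {j} {y} j<m refl y∈pair with y ≟ moverOf j
      ... | no  y≢ = trans (perm-non-mover y (λ e → y≢ (trans e (mover≡moverOf j<m))))
                       (sym (fixed-in-pair j<m y∈pair y≢))
      ... | yes y≡ = begin
        perm y                      ≡⟨ cong perm (trans y≡ (sym (mover≡moverOf j<m))) ⟩
        perm (mover j)              ≡⟨ perm-mover j<m ⟩
        mover (derangement j)       ≡⟨ mover≡moverOf (proj₁ (mover-image j<m)) ⟩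
        moverOf (derangement j)     ≡⟨ sym (proj₂ (mover-image j<m)) ⟩
        a (moverOf j)               ≡⟨ cong a (sym y≡) ⟩
        a y                         ∎
        where open ≡-Reasoning

      perm-derangement : {x : ℕ} → x < size → perm x ≡ a x
      perm-derangement {x} x<size with position x x<size
      ... | inPrefix x<s       = trans (perm-prefix x<s) (sym (fixed-prefix x<s))
      ... | inTail t t<e refl  = trans (perm-tail (tailStart≤tailPos t)) (sym (fixed-tail t<e))
      ... | inPair₀ j j<m refl = perm-in-pair j<m (pairOf-pos₀ j) (inj₁ refl)
      ... | inPair₁ j j<m refl = perm-in-pair j<m (pairOf-pos₁ j) (inj₂ refl)

  module _ {σ : ℕ → ℕ} (σ-der : IsDerangement m σ) where
    open FromDerangement σ
    open FromUpDown perm using (moverOf-cases; derangement)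

    derangement-perm : {j : ℕ} → j < m → derangement j ≡ σ j
    derangement-perm {j} j<m with j <? σ j | moverOf-cases j
    ... | yes j<σj | inj₁ (p , _) = ⊥-elim (proj₁ (mover≢pos (IsDerangement.fixedPointFree σ-der j<m))
                                       (trans (sym (perm-pos₀-< σ-der j<m j<σj)) p))
    ... | yes j<σj | inj₂ (_ , e) =
      trans (cong (pairOf ∘ perm) e) (trans (cong pairOf (perm-pos₀-< σ-der j<m j<σj)) (pairOf-mover (σ j)))
    ... | no  j≮σj | inj₁ (_ , e) =
      trans (cong (pairOf ∘ perm) e) (trans (cong pairOf (perm-pos₁-≮ σ-der j<m j≮σj)) (pairOf-mover (σ j)))
    ... | no  j≮σj | inj₂ (¬p , _) = ⊥-elim (¬p (perm-pos₀-≮ σ-der j≮σj))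

  module _ {σ τ : ℕ → ℕ} (σ≗τ : ∀ {j} → j < m → σ j ≡ τ j) where
    private
      module σ = FromDerangement σ
      module τ = FromDerangement τ

    mover-cong : {j : ℕ} → j < m → σ.mover j ≡ τ.mover j
    mover-cong {j} j<m = cong (λ k → if does (j <? k) then pos₀ j else pos₁ j) (σ≗τ j<m)

    isMover-cong : {x : ℕ} → σ.IsMover x → τ.IsMover x
    isMover-cong (s≤x , x<T , x≡) = s≤x , x<T , trans x≡ (mover-cong (pairOf-< s≤x x<T))

    isMover-cong⁻ : {x : ℕ} → τ.IsMover x → σ.IsMover x
    isMover-cong⁻ (s≤x , x<T , x≡) = s≤x , x<T , trans x≡ (sym (mover-cong (pairOf-< s≤x x<T)))

    perm-cong : (∀ {j} → j < m → σ j < m) → (x : ℕ) → σ.perm x ≡ τ.perm x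
    perm-cong σ-bounded x with σ.isMover? x
    ... | no ¬p = trans (σ.perm-¬isMover ¬p) (sym (τ.perm-¬isMover (¬p ∘ isMover-cong⁻)))
    ... | yes p@(s≤x , x<T , _) = begin
      σ.perm x                    ≡⟨ σ.perm-isMover p ⟩
      σ.mover (σ (pairOf x))      ≡⟨ mover-cong (σ-bounded x<m) ⟩
      τ.mover (σ (pairOf x))      ≡⟨ cong τ.mover (σ≗τ x<m) ⟩
      τ.mover (τ (pairOf x))      ≡⟨ sym (τ.perm-isMover (isMover-cong p)) ⟩
      τ.perm x                    ∎
      where
      open ≡-Reasoning
      x<m = pairOf-< s≤x x<T

  module _ {a b : ℕ → ℕ} (a≗b : ∀ {x} → x < size → a x ≡ b x) where
    private
      module a = FromUpDown a
      module b = FromUpDown b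

    moverOf-cong : {j : ℕ} → j < m → a.moverOf j ≡ b.moverOf j
    moverOf-cong {j} j<m = cong (λ y → if does (y ≟ pos₀ j) then pos₁ j else pos₀ j) (a≗b (pos₀<size j<m))

    derangement-cong : {j : ℕ} → j < m → a.derangement j ≡ b.derangement j
    derangement-cong j<m = cong pairOf (trans (a≗b (a.moverOf<size j<m)) (cong b (moverOf-cong j<m)))

  isUpDownWord? : (w : List (Fin size)) → Dec ((zigzag (startsDown s) w ∧ hasFix (s + (m + e)) w) ≡ true)
  isUpDownWord? w = (zigzag (startsDown s) w ∧ hasFix (s + (m + e)) w) Bool.≟ true

  UpDownWords : List (List (Fin size))
  UpDownWords = filter isUpDownWord? (perms size)

  ∈-UpDownWords⁻ : {w : List (Fin size)} → w ∈ UpDownWords → w ∈ perms size × IsUpDown (seq w)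
  ∈-UpDownWords⁻ {w} w∈
    with w∈perms , zz∧fix ← ∈-filter⁻ isUpDownWord? {xs = perms size} w∈ =
    w∈perms , record
      { isPermutation = seq-isPermutation w∈perms
      ; isZigzag      = zigzagℕ-applyUpTo⁻ (startsDown s) size (seq w)
          (trans (sym (zigzag-sequence w≡ (startsDown s))) (∧-conicalˡ _ _ zz∧fix))
      ; fixedPoints≡  = trans (sym (fixedPoints-sequence w≡)) (≡ᵇ⇒≡ (fixedPoints w) (s + (m + e))
          (subst T (sym (∧-conicalʳ (zigzag (startsDown s) w) _ zz∧fix)) tt))
      }
    where
    w≡ = sym (applyUpTo-seq w∈perms)

  word-∈-UpDownWords : {a : ℕ → ℕ} → IsUpDown a → word size a ∈ UpDownWords
  word-∈-UpDownWords {a} a-ud =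
    ∈-filter⁺ isUpDownWord? (word-∈-perms isPermutation)
      (cong₂ _∧_
        (trans (zigzag-sequence w≡ (startsDown s)) (zigzagℕ-applyUpTo⁺ (startsDown s) size a isZigzag))
        (dec-true (fixedPoints (word size a) ≟ s + (m + e)) (trans (fixedPoints-sequence w≡) fixedPoints≡)))
    where
    open IsUpDown a-ud
    w≡ = map-toℕ-word isPermutation

  length-UpDownWords : length UpDownWords ≡ D m
  length-UpDownWords = length-≡-bijection toDerangement toUpDown UpDownWords (Derangements m)
    (Unique.filter⁺ isUpDownWord? (Unique-perms size)) (Unique.filter⁺ isDerangementWord? (Unique-perms m))
    toDerangement-∈ toUpDown-∈ toUpDown-toDerangement toDerangement-toUpDown
    where
    open ≡-Reasoning

    toDerangement : List (Fin size) → List (Fin m)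
    toDerangement w = word m (FromUpDown.derangement (seq w))

    toUpDown : List (Fin m) → List (Fin size)
    toUpDown τ = word size (FromDerangement.perm (seq τ))

    toDerangement-∈ : {w : List (Fin size)} → w ∈ UpDownWords → toDerangement w ∈ Derangements m
    toDerangement-∈ {w} w∈ =
      word-∈-Derangements (FromUpDown.derangement-isDerangement (seq w) (proj₂ (∈-UpDownWords⁻ w∈)))

    toUpDown-∈ : {τ : List (Fin m)} → τ ∈ Derangements m → toUpDown τ ∈ UpDownWords
    toUpDown-∈ {τ} τ∈ =
      word-∈-UpDownWords (FromDerangement.perm-isUpDown (seq τ) (proj₂ (∈-Derangements⁻ τ∈)))

    toUpDown-toDerangement : {w : List (Fin size)} → w ∈ UpDownWords → toUpDown (toDerangement w) ≡ w
    toUpDown-toDerangement {w} w∈ with w∈perms , a-ud ← ∈-UpDownWords⁻ w∈ = begin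
      word size (FromDerangement.perm (seq (word m σ)))
        ≡⟨ word-cong size (λ {x} x<size → trans
             (perm-cong (seq-word σ-perm) (IsPermutation.bounded (seq-isPermutation (word-∈-perms σ-perm))) x)
             (FromUpDown.perm-derangement (seq w) a-ud x<size)) ⟩
      word size (seq w)
        ≡⟨ word-seq w∈perms ⟩
      w ∎
      where
      σ = FromUpDown.derangement (seq w)
      σ-perm = IsDerangement.isPermutation (FromUpDown.derangement-isDerangement (seq w) a-ud)

    toDerangement-toUpDown : {τ : List (Fin m)} → τ ∈ Derangements m → toDerangement (toUpDown τ) ≡ τ
    toDerangement-toUpDown {τ} τ∈ with τ∈perms , σ-der ← ∈-Derangements⁻ τ∈ = begin
      word m (FromUpDown.derangement (seq (word size a)))
        ≡⟨ word-cong m (λ j<m → trans (derangement-cong (seq-word a-perm) j<m) (derangement-perm σ-der j<m)) ⟩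
      word m (seq τ)
        ≡⟨ word-seq τ∈perms ⟩
      τ ∎
      where
      a = FromDerangement.perm (seq τ)
      a-perm = IsUpDown.isPermutation (FromDerangement.perm-isUpDown (seq τ) σ-der)

dbl≡2* : (m : ℕ) → dbl m ≡ 2 * m
dbl≡2* zero    = refl
dbl≡2* (suc m) = cong suc (trans (cong suc (dbl≡2* m)) (sym (+-suc m (m + 0))))

theorem2p2 : (m : ℕ) → d* (suc (suc m)) (2 * suc m) ≡ D m
    × d (suc m) (suc (2 * m)) ≡ D m
    × d* (suc m) (suc (2 * m)) ≡ D m
theorem2p2 m =
    subst₂ (λ k n → d* k n ≡ D m) (cong suc (+-comm m 1))
      (trans (cong suc (+-comm (dbl m) 1)) (dbl≡2* (suc m))) (count 1 1 ≤-refl ≤-refl)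
  , subst₂ (λ k n → d k n ≡ D m) (+-comm m 1)
      (trans (+-comm (dbl m) 1) (cong suc (dbl≡2* m))) (count 0 1 z≤n ≤-refl)
  , subst₂ (λ k n → d* k n ≡ D m) (cong suc (+-identityʳ m))
      (cong suc (trans (+-identityʳ (dbl m)) (dbl≡2* m))) (count 1 0 ≤-refl z≤n)
  where
  count : (s e : ℕ) (s≤1 : s ≤ 1) (e≤1 : e ≤ 1) → length (Blocks.UpDownWords s e m s≤1 e≤1) ≡ D m
  count s e s≤1 e≤1 = Blocks.length-UpDownWords s e m s≤1 e≤1
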